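{- Let $k\in\mathbb{Z}$ and $n,m\in\mathbb{Z}^+$. Then $\chi_{n,k}(T_m)=2$ if $n\mid mk$, and $\chi_{n,k}(T_m)=3$ otherwise.
   Context: $T_m$ is the complete $m$-ary rooted tree of infinite height: an infinite rooted tree in which every vertex has exactly $m$ children. For a graph $G=(V,E)$, a labeling $\ell:V\to\mathbb{Z}$ is proper if adjacent vertices get distinct labels, its order is the size of its image, and it is a closed coloring with remainder $k\bmod n$ if $\sum_{w\in N[v]}\ell(w)\equiv k\pmod n$ for every $v$, where $N[v]$ is the closed neighborhood of $v$. $\chi_{n,k}(G)$ is the minimum order of a proper closed coloring with remainder $k\bmod n$. -}

module Defs where

open import Data.Nat using (ℕ; _≤_)
open import Data.Integer using (ℤ; +_; _+_; _-_; 0ℤ)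
open import Data.Integer.Divisibility using (_∣_)
open import Data.Fin using (Fin)
open import Data.List using (List; []; _∷_; map; _++_; foldr; length; allFin)
open import Data.List.Membership.Propositional using (_∈_)
open import Data.List.Relation.Unary.Unique.Propositional using (Unique)
open import Data.Product using (Σ; ∃; _×_)
open import Data.Sum using (_⊎_)
open import Relation.Binary.PropositionalEquality using (_≡_; _≢_)

-- A vertex is a finite word over Fin m (the path from the root, most recent
-- step first): the root is [], and the children of v are  i ∷ v  (i : Fin m).
Vertex : ℕ → Set
Vertex m = List (Fin m)

Adj : (m : ℕ) → Vertex m → Vertex m → Set
Adj m u w = (∃ λ i → u ≡ i ∷ w) ⊎ (∃ λ i → w ≡ i ∷ u)

Labeling : ℕ → Set
Labeling m = Vertex m → ℤ

Proper : (m : ℕ) → Labeling m → Set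
Proper m ℓ = ∀ u w → Adj m u w → ℓ u ≢ ℓ w

parentList : {m : ℕ} → Vertex m → List (Vertex m)
parentList []      = []
parentList (_ ∷ p) = p ∷ []

-- closed neighborhood N[v]: v, its m children and its parent (if any);
-- these are pairwise distinct vertices
closedNbhd : (m : ℕ) → Vertex m → List (Vertex m)
closedNbhd m v = v ∷ (map (λ i → i ∷ v) (allFin m) ++ parentList v)

sumℤ : List ℤ → ℤ
sumℤ = foldr _+_ 0ℤ

ClosedColoring : (n : ℕ) (k : ℤ) (m : ℕ) → Labeling m → Set
ClosedColoring n k m ℓ = ∀ v → (+ n) ∣ (sumℤ (map ℓ (closedNbhd m v)) - k)

HasOrder : (m : ℕ) → Labeling m → ℕ → Set
HasOrder m ℓ c =
  Σ (List ℤ) λ xs → length xs ≡ c × Unique xs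
    × (∀ v → ℓ v ∈ xs) × (∀ x → x ∈ xs → ∃ λ v → ℓ v ≡ x)

ChiIs : (n : ℕ) (k : ℤ) (m : ℕ) → ℕ → Set
ChiIs n k m c =
  (Σ (Labeling m) λ ℓ → Proper m ℓ × ClosedColoring n k m ℓ × HasOrder m ℓ c)
  × (∀ (ℓ : Labeling m) (c' : ℕ) → Proper m ℓ → ClosedColoring n k m ℓ
       → HasOrder m ℓ c' → c ≤ c')

-- If n ∣ mk, give the vertices of even depth a label a ≡ k (mod n) with a ≠ 0 and those
-- of odd depth the label 0: a closed neighbourhood then sums to a or to (m + 1) a, both
-- ≡ k. Otherwise use a perfect code D of T_m containing the root (every closed
-- neighbourhood meets D exactly once): label D by k and properly 2-colour the rest with
-- 0 and n, so every closed sum is k plus multiples of n.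
-- Conversely a proper labeling of T_m needs two labels, and a proper labeling with only
-- two labels α, β alternates with depth. The closed sums at depths 0 and 2 then differ
-- by β, so n ∣ β, whence α ≡ k from depth 0, and depth 1 gives (m + 1) k ≡ k.
module Submission where

open import Defs
open import Data.Bool using (Bool; true; false; not)
open import Data.Empty using (⊥-elim)
open import Data.Fin using (Fin; zero; suc)
open import Data.Integer using (ℤ; +_; _+_; _-_; _*_; 0ℤ; 1ℤ)
open import Data.Integer.Divisibility using (_∣_)
open import Data.Integer.Divisibility.Signed
  using (divides; ∣ᵤ⇒∣; ∣⇒∣ᵤ; ∣-refl; ∣m∣n⇒∣m+n; ∣m∣n⇒∣m-n; ∣n⇒∣m*n)
  renaming (_∣_ to _∣ₛ_)
open import Data.Integer.Properties
  using (_≟_; +-identityˡ; +-identityʳ; +-assoc; +-inverseʳ; *-identityˡ; *-zeroʳ; suc-*)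
open import Data.Integer.Tactic.RingSolver using (solve-∀)
open import Data.List using (List; []; _∷_; map; _++_; length; tabulate)
open import Data.List.Properties using (map-++; map-tabulate; tabulate-cong)
open import Data.List.Membership.Propositional using (_∈_)
open import Data.List.Relation.Unary.Any using (here; there)
open import Data.List.Relation.Unary.All using ([]; _∷_)
open import Data.List.Relation.Unary.AllPairs using ([]; _∷_)
open import Data.Nat using (ℕ; zero; suc; _≤_; _≥_; s≤s; z≤n)
open import Data.Nat.Properties using (≤∧≢⇒<)
open import Data.Product using (Σ; ∃; _×_; _,_)
open import Data.Sum using (inj₁; inj₂)
open import Function using (_∘_)
open import Relation.Nullary using (¬_; yes; no)
open import Relation.Binary.PropositionalEquality

sumℤ-++ : ∀ xs ys → sumℤ (xs ++ ys) ≡ sumℤ xs + sumℤ ys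
sumℤ-++ []       ys = sym (+-identityˡ (sumℤ ys))
sumℤ-++ (x ∷ xs) ys =
  trans (cong (λ s → x + s) (sumℤ-++ xs ys)) (sym (+-assoc x (sumℤ xs) (sumℤ ys)))

sumℤ-tabulate-const : ∀ m (c : ℤ) → sumℤ (tabulate {n = m} (λ _ → c)) ≡ + m * c
sumℤ-tabulate-const zero    c = refl
sumℤ-tabulate-const (suc m) c =
  trans (cong (λ s → c + s) (sumℤ-tabulate-const m c)) (sym (suc-* (+ m) c))

≢-≢⇒≡-length2 : ∀ {A : Set} {xs : List A} {p q r : A} → length xs ≡ 2 →
  p ∈ xs → q ∈ xs → r ∈ xs → p ≢ q → r ≢ q → p ≡ r
≢-≢⇒≡-length2 {xs = _ ∷ _ ∷ []} _ (here refl) (here refl) _ p≢q _ = ⊥-elim (p≢q refl)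
≢-≢⇒≡-length2 {xs = _ ∷ _ ∷ []} _ _ (here refl) (here refl) _ r≢q = ⊥-elim (r≢q refl)
≢-≢⇒≡-length2 {xs = _ ∷ _ ∷ []} _ (here refl) (there (here refl)) (here refl) _ _ = refl
≢-≢⇒≡-length2 {xs = _ ∷ _ ∷ []} _ (there (here refl)) (there (here refl)) _ p≢q _ =
  ⊥-elim (p≢q refl)
≢-≢⇒≡-length2 {xs = _ ∷ _ ∷ []} _ _ (there (here refl)) (there (here refl)) _ r≢q =
  ⊥-elim (r≢q refl)
≢-≢⇒≡-length2 {xs = _ ∷ _ ∷ []} _ (there (here refl)) (here refl) (there (here refl)) _ _ =
  refl

distinct-∈⇒2≤length : ∀ {A : Set} {xs : List A} {x y : A} →
  x ∈ xs → y ∈ xs → x ≢ y → 2 ≤ length xs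
distinct-∈⇒2≤length {xs = _ ∷ _ ∷ _} _ _ _ = s≤s (s≤s z≤n)
distinct-∈⇒2≤length {xs = _ ∷ []} (here refl) (here refl) x≢y = ⊥-elim (x≢y refl)

childSum : ∀ {m} → Labeling m → Vertex m → ℤ
childSum ℓ v = sumℤ (tabulate λ i → ℓ (i ∷ v))

sum-closedNbhd : ∀ {m} (ℓ : Labeling m) v →
  sumℤ (map ℓ (closedNbhd m v)) ≡ ℓ v + (childSum ℓ v + sumℤ (map ℓ (parentList v)))
sum-closedNbhd {m} ℓ v = cong (λ s → ℓ v + s) (begin
  sumℤ (map ℓ (children ++ parentList v))
    ≡⟨ cong sumℤ (map-++ ℓ children (parentList v)) ⟩
  sumℤ (map ℓ children ++ map ℓ (parentList v))
    ≡⟨ sumℤ-++ (map ℓ children) (map ℓ (parentList v)) ⟩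
  sumℤ (map ℓ children) + sumℤ (map ℓ (parentList v))
    ≡⟨ cong (λ xs → sumℤ xs + sumℤ (map ℓ (parentList v))) map-children ⟩
  childSum ℓ v + sumℤ (map ℓ (parentList v)) ∎)
  where
  open ≡-Reasoning
  children : List (Vertex m)
  children = map (_∷ v) (tabulate λ i → i)
  map-children : map ℓ children ≡ tabulate λ i → ℓ (i ∷ v)
  map-children = trans (cong (map ℓ) (map-tabulate (λ i → i) (_∷ v))) (map-tabulate (_∷ v) ℓ)

sum-closedNbhd-root : ∀ {m} (ℓ : Labeling m) →
  sumℤ (map ℓ (closedNbhd m [])) ≡ ℓ [] + childSum ℓ []
sum-closedNbhd-root ℓ = trans (sum-closedNbhd ℓ []) (cong (λ s → ℓ [] + s) (+-identityʳ (childSum ℓ [])))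

sum-closedNbhd-child : ∀ {m} (ℓ : Labeling m) i v →
  sumℤ (map ℓ (closedNbhd m (i ∷ v))) ≡ ℓ (i ∷ v) + childSum ℓ (i ∷ v) + ℓ v
sum-closedNbhd-child ℓ i v = begin
  sumℤ (map ℓ (closedNbhd _ (i ∷ v)))       ≡⟨ sum-closedNbhd ℓ (i ∷ v) ⟩
  ℓ (i ∷ v) + (childSum ℓ (i ∷ v) + (ℓ v + 0ℤ))
    ≡⟨ cong (λ x → ℓ (i ∷ v) + (childSum ℓ (i ∷ v) + x)) (+-identityʳ (ℓ v)) ⟩
  ℓ (i ∷ v) + (childSum ℓ (i ∷ v) + ℓ v)    ≡⟨ sym (+-assoc (ℓ (i ∷ v)) _ _) ⟩
  ℓ (i ∷ v) + childSum ℓ (i ∷ v) + ℓ v      ∎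
  where open ≡-Reasoning

childSum-uniform : ∀ {m} {ℓ : Labeling m} {v c} → (∀ i → ℓ (i ∷ v) ≡ c) →
  childSum ℓ v ≡ + m * c
childSum-uniform {m} {c = c} children≡c =
  trans (cong sumℤ (tabulate-cong children≡c)) (sumℤ-tabulate-const m c)

module _ {n : ℕ} {k : ℤ} {m : ℕ} {ℓ : Labeling m} where

  ClosedColoring⇒root : ClosedColoring n k m ℓ → + n ∣ₛ ℓ [] + childSum ℓ [] - k
  ClosedColoring⇒root closed =
    subst (λ s → + n ∣ₛ s - k) (sum-closedNbhd-root ℓ) (∣ᵤ⇒∣ (closed []))

  ClosedColoring⇒child : ClosedColoring n k m ℓ →
    ∀ i v → + n ∣ₛ ℓ (i ∷ v) + childSum ℓ (i ∷ v) + ℓ v - k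
  ClosedColoring⇒child closed i v =
    subst (λ s → + n ∣ₛ s - k) (sum-closedNbhd-child ℓ i v) (∣ᵤ⇒∣ (closed (i ∷ v)))

  local⇒ClosedColoring : + n ∣ₛ ℓ [] + childSum ℓ [] - k →
    (∀ i v → + n ∣ₛ ℓ (i ∷ v) + childSum ℓ (i ∷ v) + ℓ v - k) → ClosedColoring n k m ℓ
  local⇒ClosedColoring root child []      =
    ∣⇒∣ᵤ (subst (λ s → + n ∣ₛ s - k) (sym (sum-closedNbhd-root ℓ)) root)
  local⇒ClosedColoring root child (i ∷ v) =
    ∣⇒∣ᵤ (subst (λ s → + n ∣ₛ s - k) (sym (sum-closedNbhd-child ℓ i v)) (child i v))

module Automaton {S : Set} {m : ℕ} (step : Fin m → S → S) (start : S) (label : S → ℤ) where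

  state : Vertex m → S
  state []      = start
  state (i ∷ v) = step i (state v)

  labeling : Labeling m
  labeling v = label (state v)

  localSum : S → ℤ
  localSum s = label s + sumℤ (tabulate λ i → label (step i s))

  labeling-proper : (∀ i s → label (step i s) ≢ label s) → Proper m labeling
  labeling-proper step≢ u w (inj₁ (i , refl)) = step≢ i (state w)
  labeling-proper step≢ u w (inj₂ (i , refl)) = step≢ i (state u) ∘ sym

  labeling-closed : ∀ {n k} → + n ∣ₛ localSum start - k →
    (∀ i s → + n ∣ₛ localSum (step i s) + label s - k) → ClosedColoring n k m labeling
  labeling-closed root child =
    local⇒ClosedColoring {ℓ = labeling} root (λ i v → child i (state v))

parityLabel : ℤ → Bool → ℤ
parityLabel a true  = a
parityLabel a false = 0ℤ

module ParityLabeling (m : ℕ) (a : ℤ) where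

  open Automaton {m = m} (λ _ → not) true (parityLabel a) public

  proper : a ≢ 0ℤ → Proper m labeling
  proper a≢0 = labeling-proper step≢
    where
    step≢ : ∀ (i : Fin m) b → parityLabel a (not b) ≢ parityLabel a b
    step≢ _ true  = a≢0 ∘ sym
    step≢ _ false = a≢0

  closed : ∀ {n k} → + n ∣ₛ a - k → + n ∣ₛ + m * k → ClosedColoring n k m labeling
  closed {n} {k} a≡k n∣mk = labeling-closed even (λ { _ true → odd ; _ false → even₀ })
    where
    even-sum : ∀ a k M → a + M * 0ℤ - k ≡ a - k
    even-sum = solve-∀
    odd-sum : ∀ a k M → 0ℤ + M * a + a - k ≡ (1ℤ + M) * (a - k) + M * k
    odd-sum = solve-∀
    even : + n ∣ₛ localSum true - k
    even = subst (+ n ∣ₛ_)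
      (sym (trans (cong (λ s → a + s - k) (sumℤ-tabulate-const m 0ℤ)) (even-sum a k (+ m))))
      a≡k
    even₀ : + n ∣ₛ localSum true + 0ℤ - k
    even₀ = subst (λ s → + n ∣ₛ s - k) (sym (+-identityʳ (localSum true))) even
    odd : + n ∣ₛ localSum false + a - k
    odd = subst (+ n ∣ₛ_)
      (sym (trans (cong (λ s → 0ℤ + s + a - k) (sumℤ-tabulate-const m a)) (odd-sum a k (+ m))))
      (∣m∣n⇒∣m+n (∣n⇒∣m*n (1ℤ + + m) a≡k) n∣mk)

  hasOrder : Fin m → a ≢ 0ℤ → HasOrder m labeling 2
  hasOrder i a≢0 = a ∷ 0ℤ ∷ [] , refl , (a≢0 ∷ []) ∷ [] ∷ [] , (λ v → ∈-image (state v)) , hit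
    where
    ∈-image : ∀ b → parityLabel a b ∈ a ∷ 0ℤ ∷ []
    ∈-image true  = here refl
    ∈-image false = there (here refl)
    hit : ∀ x → x ∈ a ∷ 0ℤ ∷ [] → ∃ λ v → labeling v ≡ x
    hit x (here refl)         = [] , refl
    hit x (there (here refl)) = i ∷ [] , refl

nonzero-≡-mod : ∀ n' k → Σ ℤ λ a → (+ suc n' ∣ₛ a - k) × a ≢ 0ℤ
nonzero-≡-mod n' k with k ≟ 0ℤ
... | yes refl =
  + suc n' , divides 1ℤ (trans (+-identityʳ (+ suc n')) (sym (*-identityˡ (+ suc n')))) , λ ()
... | no k≢0   = k , divides 0ℤ (+-inverseʳ k) , k≢0

-- The roles of a vertex with respect to a perfect code D: it lies in D, its parent lies
-- in D, or one of its children does (and then it is the first child); the index of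
-- aboveCode records which of 0 and n it is labelled by.
data Role : Set where
  inCode belowCode aboveCode₀ aboveCodeₙ : Role

firstChild laterChild : Role → Role
firstChild inCode     = belowCode
firstChild belowCode  = aboveCodeₙ
firstChild aboveCode₀ = inCode
firstChild aboveCodeₙ = inCode
laterChild inCode     = belowCode
laterChild belowCode  = aboveCodeₙ
laterChild aboveCode₀ = aboveCodeₙ
laterChild aboveCodeₙ = aboveCode₀

childRole : ∀ {m} → Fin m → Role → Role
childRole zero    = firstChild
childRole (suc _) = laterChild

codeLabel : ℤ → ℕ → Role → ℤ
codeLabel k n inCode     = k
codeLabel k n belowCode  = 0ℤ
codeLabel k n aboveCode₀ = 0ℤ
codeLabel k n aboveCodeₙ = + n

module CodeLabeling (k : ℤ) (n m' : ℕ) where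

  open Automaton {m = suc m'} childRole inCode (codeLabel k n) public

  L : Role → ℤ
  L = codeLabel k n

  proper : k ≢ 0ℤ → k ≢ + n → + n ≢ 0ℤ → Proper (suc m') labeling
  proper k≢0 k≢n n≢0 = labeling-proper λ { zero → first≢ ; (suc _) → later≢ }
    where
    first≢ : ∀ s → L (firstChild s) ≢ L s
    first≢ inCode     = k≢0 ∘ sym
    first≢ belowCode  = n≢0
    first≢ aboveCode₀ = k≢0
    first≢ aboveCodeₙ = k≢n
    later≢ : ∀ s → L (laterChild s) ≢ L s
    later≢ inCode     = k≢0 ∘ sym
    later≢ belowCode  = n≢0
    later≢ aboveCode₀ = n≢0
    later≢ aboveCodeₙ = n≢0 ∘ sym

  localSum-split : ∀ t → localSum t ≡ L t + (L (firstChild t) + + m' * L (laterChild t))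
  localSum-split t = cong (λ s → L t + (L (firstChild t) + s)) (sumℤ-tabulate-const m' _)

  closed : ClosedColoring n k (suc m') labeling
  closed = labeling-closed
    (subst (λ s → + n ∣ₛ s - k) (sym (localSum-split inCode)) (divides 0ℤ (sum₀ k N M)))
    λ { zero s → split (firstChild s) (first s) ; (suc _) s → split (laterChild s) (later s) }
    where
    N = + n
    M = + m'
    split : ∀ t {s} → + n ∣ₛ L t + (L (firstChild t) + M * L (laterChild t)) + L s - k →
      + n ∣ₛ localSum t + L s - k
    split t {s} = subst (λ x → + n ∣ₛ x + L s - k) (sym (localSum-split t))
    sum₀ : ∀ k N M → k + (0ℤ + M * 0ℤ) - k ≡ 0ℤ * N
    sum₀ = solve-∀
    sum-below : ∀ k N M → 0ℤ + (N + M * N) + k - k ≡ (1ℤ + M) * N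
    sum-below = solve-∀
    sum-aboveₙ : ∀ k N M → N + (k + M * 0ℤ) + 0ℤ - k ≡ 1ℤ * N
    sum-aboveₙ = solve-∀
    sum-in : ∀ k M P → k + (0ℤ + M * 0ℤ) + P - k ≡ 1ℤ * P
    sum-in = solve-∀
    sum-above₀ : ∀ k N M → 0ℤ + (k + M * N) + N - k ≡ (1ℤ + M) * N
    sum-above₀ = solve-∀
    first : ∀ s → + n ∣ₛ L (firstChild s) + (L (firstChild (firstChild s))
      + M * L (laterChild (firstChild s))) + L s - k
    first inCode     = divides (1ℤ + M) (sum-below k N M)
    first belowCode  = divides 1ℤ (sum-aboveₙ k N M)
    first aboveCode₀ = divides 0ℤ (sum-in k M 0ℤ)
    first aboveCodeₙ = divides 1ℤ (sum-in k M N)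
    later : ∀ s → + n ∣ₛ L (laterChild s) + (L (firstChild (laterChild s))
      + M * L (laterChild (laterChild s))) + L s - k
    later inCode     = divides (1ℤ + M) (sum-below k N M)
    later belowCode  = divides 1ℤ (sum-aboveₙ k N M)
    later aboveCode₀ = divides 1ℤ (sum-aboveₙ k N M)
    later aboveCodeₙ = divides (1ℤ + M) (sum-above₀ k N M)

  hasOrder : k ≢ 0ℤ → k ≢ + n → + n ≢ 0ℤ → HasOrder (suc m') labeling 3
  hasOrder k≢0 k≢n n≢0 =
    k ∷ 0ℤ ∷ + n ∷ [] , refl , (k≢0 ∷ k≢n ∷ []) ∷ ((n≢0 ∘ sym) ∷ []) ∷ [] ∷ [] ,
    (λ v → ∈-image (state v)) , hit
    where
    ∈-image : ∀ s → L s ∈ k ∷ 0ℤ ∷ + n ∷ []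
    ∈-image inCode     = here refl
    ∈-image belowCode  = there (here refl)
    ∈-image aboveCode₀ = there (here refl)
    ∈-image aboveCodeₙ = there (there (here refl))
    hit : ∀ x → x ∈ k ∷ 0ℤ ∷ + n ∷ [] → ∃ λ v → labeling v ≡ x
    hit x (here refl)                 = [] , refl
    hit x (there (here refl))         = zero ∷ [] , refl
    hit x (there (there (here refl))) = zero ∷ zero ∷ [] , refl

proper⇒2≤order : ∀ {m' ℓ c} → Proper (suc m') ℓ → HasOrder (suc m') ℓ c → 2 ≤ c
proper⇒2≤order proper (_ , refl , _ , ∈xs , _) =
  distinct-∈⇒2≤length (∈xs (zero ∷ [])) (∈xs []) (proper _ _ (inj₁ (zero , refl)))

module TwoLabels {m : ℕ} {ℓ : Labeling m} {xs : List ℤ} (proper : Proper m ℓ)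
                 (length≡2 : length xs ≡ 2) (∈xs : ∀ v → ℓ v ∈ xs) where

  child≢parent : ∀ i v → ℓ (i ∷ v) ≢ ℓ v
  child≢parent i v = proper _ _ (inj₁ (i , refl))

  siblings≡ : ∀ i j v → ℓ (i ∷ v) ≡ ℓ (j ∷ v)
  siblings≡ i j v = ≢-≢⇒≡-length2 length≡2 (∈xs _) (∈xs v) (∈xs _)
    (child≢parent i v) (child≢parent j v)

  grandchild≡ : ∀ i j v → ℓ (i ∷ j ∷ v) ≡ ℓ v
  grandchild≡ i j v = ≢-≢⇒≡-length2 length≡2 (∈xs _) (∈xs (j ∷ v)) (∈xs v)
    (child≢parent i (j ∷ v)) (child≢parent j v ∘ sym)

alternating⇒∣ : ∀ {N k α β : ℤ} M → N ∣ₛ α + M * β - k → N ∣ₛ β + M * α + α - k →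
  N ∣ₛ α + M * β + β - k → N ∣ₛ M * k
alternating⇒∣ {N} {k} {α} {β} M depth₀ depth₁ depth₂ =
  subst (N ∣ₛ_) (cancel₃ α β k M) (∣m∣n⇒∣m-n (∣m∣n⇒∣m-n depth₁ (∣n⇒∣m*n (1ℤ + M) α≡k)) N∣β)
  where
  cancel₁ : ∀ α β k M → α + M * β + β - k - (α + M * β - k) ≡ β
  cancel₁ = solve-∀
  cancel₂ : ∀ α β k M → α + M * β - k - M * β ≡ α - k
  cancel₂ = solve-∀
  cancel₃ : ∀ α β k M → β + M * α + α - k - (1ℤ + M) * (α - k) - β ≡ M * k
  cancel₃ = solve-∀
  N∣β : N ∣ₛ β
  N∣β = subst (N ∣ₛ_) (cancel₁ α β k M) (∣m∣n⇒∣m-n depth₂ depth₀)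
  α≡k : N ∣ₛ α - k
  α≡k = subst (N ∣ₛ_) (cancel₂ α β k M) (∣m∣n⇒∣m-n depth₀ (∣n⇒∣m*n M N∣β))

order2⇒∣ : ∀ {n k m' ℓ} → Proper (suc m') ℓ → ClosedColoring n k (suc m') ℓ →
  HasOrder (suc m') ℓ 2 → + n ∣ₛ + suc m' * k
order2⇒∣ {n} {k} {m'} {ℓ} proper closed (_ , length≡2 , _ , ∈xs , _) =
  alternating⇒∣ {α = ℓ []} {β = ℓ v₁} (+ suc m') depth₀ depth₁ depth₂
  where
  open TwoLabels proper length≡2 ∈xs
  v₁ : Vertex (suc m')
  v₁ = zero ∷ []
  depth₀ : + n ∣ₛ ℓ [] + + suc m' * ℓ v₁ - k
  depth₀ = subst (λ s → + n ∣ₛ ℓ [] + s - k)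
    (childSum-uniform {ℓ = ℓ} (λ i → siblings≡ i zero [])) (ClosedColoring⇒root {ℓ = ℓ} closed)
  depth₁ : + n ∣ₛ ℓ v₁ + + suc m' * ℓ [] + ℓ [] - k
  depth₁ = subst (λ s → + n ∣ₛ ℓ v₁ + s + ℓ [] - k)
    (childSum-uniform {ℓ = ℓ} (λ i → grandchild≡ i zero []))
    (ClosedColoring⇒child {ℓ = ℓ} closed zero [])
  depth₂ : + n ∣ₛ ℓ [] + + suc m' * ℓ v₁ + ℓ v₁ - k
  depth₂ = subst₂ (λ x s → + n ∣ₛ x + s + ℓ v₁ - k)
    (grandchild≡ zero zero []) (childSum-uniform {ℓ = ℓ} (λ i → grandchild≡ i zero v₁))
    (ClosedColoring⇒child {ℓ = ℓ} closed zero v₁)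

theorem5p1 : (k : ℤ) (n m : ℕ) → n ≥ 1 → m ≥ 1 →
    ((+ n) ∣ ((+ m) * k) → ChiIs n k m 2)
    × (¬ ((+ n) ∣ ((+ m) * k)) → ChiIs n k m 3)
theorem5p1 k (suc n') (suc m') _ _ = χ≡2 , χ≡3
  where
  n = suc n'
  m = suc m'

  χ≡2 : (+ n) ∣ ((+ m) * k) → ChiIs n k m 2
  χ≡2 n∣mk with nonzero-≡-mod n' k
  ... | a , a≡k , a≢0 =
    (labeling , proper a≢0 , closed a≡k (∣ᵤ⇒∣ n∣mk) , hasOrder zero a≢0) ,
    λ _ _ proper′ _ order → proper⇒2≤order proper′ order
    where open ParityLabeling m a

  χ≡3 : ¬ ((+ n) ∣ ((+ m) * k)) → ChiIs n k m 3
  χ≡3 n∤mk =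
    (labeling , proper k≢0 k≢n (λ ()) , closed , hasOrder k≢0 k≢n (λ ())) ,
    λ _ c proper′ closed′ order → ≤∧≢⇒< (proper⇒2≤order proper′ order)
      λ { refl → n∤mk (∣⇒∣ᵤ (order2⇒∣ proper′ closed′ order)) }
    where
    open CodeLabeling k n m'
    k≢0 : k ≢ 0ℤ
    k≢0 refl = n∤mk (∣⇒∣ᵤ {+ n} (divides 0ℤ (*-zeroʳ (+ m))))
    k≢n : k ≢ + n
    k≢n refl = n∤mk (∣⇒∣ᵤ (∣n⇒∣m*n (+ m) (∣-refl {+ n})))
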